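{- Let $G$ be a $G$-formula and let $\Gamma$ be a finite multiset of $D$-formulas. Then $\Gamma \vdash_C G$ if and only if $G\supset\bot,\Gamma\vdash_O G$.
   Context: Formulas are those of a first-order language with logical symbols $\top,\bot,\land,\lor,\supset,\exists,\forall$; $\top$ and $\bot$ are not atomic. $[t/x]B$ is capture-avoiding substitution. A sequent $\Gamma\longrightarrow\Delta$ is a pair of finite multisets of formulas; $B,\Gamma$ denotes $\Gamma$ with one extra occurrence of $B$. A sequent is an axiom if $\top\in\Delta$, or some $A$ that is $\bot$ or atomic lies in both $\Gamma$ and $\Delta$. Inference rules (upper sequents $\Rightarrow$ lower sequent): contr-L: $B,B,\Gamma\longrightarrow\Delta \Rightarrow B,\Gamma\longrightarrow\Delta$; contr-R: $\Gamma\longrightarrow\Delta,B,B\Rightarrow\Gamma\longrightarrow\Delta,B$; $\bot$-R: $\Gamma\longrightarrow\Delta,\bot\Rightarrow\Gamma\longrightarrow\Delta,D$; $\land$-L: $B,D,B\land D,\Gamma\longrightarrow\Delta\Rightarrow B\land D,\Gamma\longrightarrow\Delta$; $\land$-R: $\Gamma\longrightarrow\Delta,B$ and $\Gamma\longrightarrow\Delta,D\Rightarrow\Gamma\longrightarrow\Delta,B\land D$; $\lor$-L: $B,\Gamma\longrightarrow\Delta$ and $D,\Gamma\longrightarrow\Delta\Rightarrow B\lor D,\Gamma\longrightarrow\Delta$; $\lor$-R: $\Gamma\longrightarrow\Delta,B$ (or $\Gamma\longrightarrow\Delta,D$) $\Rightarrow\Gamma\longrightarrow\Delta,B\lor D$;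 $\supset$-L: $B\supset D,\Gamma\longrightarrow B,\Delta$ and $D,\Gamma\longrightarrow\Theta\Rightarrow B\supset D,\Gamma\longrightarrow\Delta,\Theta$; $\supset$-R: $B,\Gamma\longrightarrow\Delta,D\Rightarrow\Gamma\longrightarrow\Delta,B\supset D$; $\forall$-L: $[t/x]B,\forall x B,\Gamma\longrightarrow\Delta\Rightarrow\forall xB,\Gamma\longrightarrow\Delta$; $\exists$-R: $\Gamma\longrightarrow\Delta,[t/x]B\Rightarrow\Gamma\longrightarrow\Delta,\exists xB$ ($t$ any term); $\exists$-L: $[c/x]B,\Gamma\longrightarrow\Delta\Rightarrow\exists xB,\Gamma\longrightarrow\Delta$ and $\forall$-R: $\Gamma\longrightarrow\Delta,[c/x]B\Rightarrow\Gamma\longrightarrow\Delta,\forall xB$, where the constant $c$ does not occur in the lower sequent. A C-proof is a finite derivation tree using these rules with axioms at the leaves; $\Gamma\vdash_C B$ means $\Gamma\longrightarrow B$ has a C-proof. An I-proof is a C-proof in which every sequent has exactly one succedent formula. A uniform proof is an I-proof in which every sequent whose succedent formula has a top-level connective or quantifier among $\land,\lor,\supset,\exists,\forall$ occurs only as the lower sequent of the inference rule introducing that top-level symbol; $\Gamma\vdash_O B$ means $\Gamma\longrightarrow B$ has a uniform proof. $G$-formulas and $D$-formulas: $G ::= \top \mid \bot \mid A \mid G\land G \mid G\lor G \mid D\supset G \mid \exists x\, G$ and $D ::= \top \mid \bot \mid A \mid G\supset D \mid D\land D \mid D\lor D \mid \exists x\, D \mid \forall x\, D$, $A$ atomic.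 -}

module Defs where

open import Data.Nat using (ℕ; zero; suc)
open import Data.Fin using (Fin; zero; suc)
open import Data.List using (List; []; _∷_; _++_; length)
open import Data.List.Relation.Unary.Any using (Any)
open import Data.List.Relation.Unary.All using (All)
open import Data.List.Membership.Propositional using (_∈_)
open import Data.List.Relation.Binary.Permutation.Propositional using (_↭_)
open import Data.Product using (Σ; _×_)
open import Data.Sum using (_⊎_)
open import Data.Unit using (⊤)
open import Data.Empty using (⊥)
open import Relation.Nullary using (¬_)
open import Relation.Binary.PropositionalEquality using (_≡_)

-- First-order terms and formulas (well-scoped de Bruijn; n = number of
-- bound variables in scope).

data Term (n : ℕ) : Set where
  var : Fin n → Term n
  fun : ℕ → List (Term n) → Term n

const : ∀ {n} → ℕ → Term n
const c = fun c []

mutual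
  ren : ∀ {m n} → (Fin m → Fin n) → Term m → Term n
  ren ρ (var i)    = var (ρ i)
  ren ρ (fun f ts) = fun f (renL ρ ts)

  renL : ∀ {m n} → (Fin m → Fin n) → List (Term m) → List (Term n)
  renL ρ []       = []
  renL ρ (t ∷ ts) = ren ρ t ∷ renL ρ ts

mutual
  sub : ∀ {m n} → (Fin m → Term n) → Term m → Term n
  sub σ (var i)    = σ i
  sub σ (fun f ts) = fun f (subL σ ts)

  subL : ∀ {m n} → (Fin m → Term n) → List (Term m) → List (Term n)
  subL σ []       = []
  subL σ (t ∷ ts) = sub σ t ∷ subL σ ts

lift : ∀ {m n} → (Fin m → Term n) → Fin (suc m) → Term (suc n)
lift σ zero    = var zero
lift σ (suc i) = ren suc (σ i)

infixr 6 _∧'_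
infixr 5 _∨'_
infixr 4 _⊃'_

data Formula (n : ℕ) : Set where
  ⊤' ⊥'  : Formula n
  atom   : ℕ → List (Term n) → Formula n
  _∧'_ _∨'_ _⊃'_ : Formula n → Formula n → Formula n
  ∃' ∀'  : Formula (suc n) → Formula n

substF : ∀ {m n} → (Fin m → Term n) → Formula m → Formula n
substF σ ⊤'          = ⊤'
substF σ ⊥'          = ⊥'
substF σ (atom p ts) = atom p (subL σ ts)
substF σ (B ∧' D)    = substF σ B ∧' substF σ D
substF σ (B ∨' D)    = substF σ B ∨' substF σ D
substF σ (B ⊃' D)    = substF σ B ⊃' substF σ D
substF σ (∃' B)      = ∃' (substF (lift σ) B)
substF σ (∀' B)      = ∀' (substF (lift σ) B)

inst : ∀ {n} → Formula (suc n) → Term n → Formula n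
inst B t = substF σ B
  where
  σ : _ → _
  σ zero    = t
  σ (suc i) = var i

data OccT {n : ℕ} (c : ℕ) : Term n → Set where
  here   : OccT c (fun c [])
  inside : ∀ {f ts} → Any (OccT c) ts → OccT c (fun f ts)

data OccF (c : ℕ) : ∀ {n} → Formula n → Set where
  atomO : ∀ {n p} {ts : List (Term n)} → Any (OccT c) ts → OccF c (atom p ts)
  ∧O₁ : ∀ {n} {B D : Formula n} → OccF c B → OccF c (B ∧' D)
  ∧O₂ : ∀ {n} {B D : Formula n} → OccF c D → OccF c (B ∧' D)
  ∨O₁ : ∀ {n} {B D : Formula n} → OccF c B → OccF c (B ∨' D)
  ∨O₂ : ∀ {n} {B D : Formula n} → OccF c D → OccF c (B ∨' D)
  ⊃O₁ : ∀ {n} {B D : Formula n} → OccF c B → OccF c (B ⊃' D)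
  ⊃O₂ : ∀ {n} {B D : Formula n} → OccF c D → OccF c (B ⊃' D)
  ∃O  : ∀ {n} {B : Formula (suc n)} → OccF c B → OccF c (∃' B)
  ∀O  : ∀ {n} {B : Formula (suc n)} → OccF c B → OccF c (∀' B)

Fm : Set
Fm = Formula 0

Fresh : ℕ → List Fm → List Fm → Set
Fresh c Γ Δ = ¬ Any (OccF c) Γ × ¬ Any (OccF c) Δ

data AtomOrBot : Fm → Set where
  isAtom : ∀ {p ts} → AtomOrBot (atom p ts)
  isBot  : AtomOrBot ⊥'

-- C-proofs.  Multisets are lists modulo permutation (_↭_): the lower
-- sequent of each rule is any sequent that is a permutation of the
-- displayed one.

variable
  Γ Γ₀ Δ Δ₀ Δ₁ Θ : List Fm
  A B D : Fm
  B₁ : Formula 1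

infix 3 _⟶_

data _⟶_ : List Fm → List Fm → Set where
  ax⊤    : ⊤' ∈ Δ → Γ ⟶ Δ
  axA    : AtomOrBot A → A ∈ Γ → A ∈ Δ → Γ ⟶ Δ
  contrL : Γ ↭ B ∷ Γ₀ → B ∷ B ∷ Γ₀ ⟶ Δ → Γ ⟶ Δ
  contrR : Δ ↭ B ∷ Δ₀ → Γ ⟶ B ∷ B ∷ Δ₀ → Γ ⟶ Δ
  ⊥R     : Δ ↭ D ∷ Δ₀ → Γ ⟶ ⊥' ∷ Δ₀ → Γ ⟶ Δ
  ∧L     : Γ ↭ (B ∧' D) ∷ Γ₀ → B ∷ D ∷ (B ∧' D) ∷ Γ₀ ⟶ Δ → Γ ⟶ Δ
  ∧R     : Δ ↭ (B ∧' D) ∷ Δ₀ → Γ ⟶ B ∷ Δ₀ → Γ ⟶ D ∷ Δ₀ → Γ ⟶ Δ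
  ∨L     : Γ ↭ (B ∨' D) ∷ Γ₀ → B ∷ Γ₀ ⟶ Δ → D ∷ Γ₀ ⟶ Δ → Γ ⟶ Δ
  ∨R₁    : Δ ↭ (B ∨' D) ∷ Δ₀ → Γ ⟶ B ∷ Δ₀ → Γ ⟶ Δ
  ∨R₂    : Δ ↭ (B ∨' D) ∷ Δ₀ → Γ ⟶ D ∷ Δ₀ → Γ ⟶ Δ
  ⊃L     : Γ ↭ (B ⊃' D) ∷ Γ₀ → Δ ↭ Δ₁ ++ Θ →
           (B ⊃' D) ∷ Γ₀ ⟶ B ∷ Δ₁ → D ∷ Γ₀ ⟶ Θ → Γ ⟶ Δ
  ⊃R     : Δ ↭ (B ⊃' D) ∷ Δ₀ → B ∷ Γ ⟶ D ∷ Δ₀ → Γ ⟶ Δ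
  ∀L     : Γ ↭ ∀' B₁ ∷ Γ₀ → (t : Term 0) →
           inst B₁ t ∷ ∀' B₁ ∷ Γ₀ ⟶ Δ → Γ ⟶ Δ
  ∃R     : Δ ↭ ∃' B₁ ∷ Δ₀ → (t : Term 0) →
           Γ ⟶ inst B₁ t ∷ Δ₀ → Γ ⟶ Δ
  ∃L     : Γ ↭ ∃' B₁ ∷ Γ₀ → (c : ℕ) → Fresh c Γ Δ →
           inst B₁ (const c) ∷ Γ₀ ⟶ Δ → Γ ⟶ Δ
  ∀R     : Δ ↭ ∀' B₁ ∷ Δ₀ → (c : ℕ) → Fresh c Γ Δ →
           Γ ⟶ inst B₁ (const c) ∷ Δ₀ → Γ ⟶ Δ

Every : (P : ∀ {Γ Δ} → Γ ⟶ Δ → Set) → ∀ {Γ Δ} → Γ ⟶ Δ → Set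
Every P p@(ax⊤ _)          = P p
Every P p@(axA _ _ _)      = P p
Every P p@(contrL _ q)     = P p × Every P q
Every P p@(contrR _ q)     = P p × Every P q
Every P p@(⊥R _ q)         = P p × Every P q
Every P p@(∧L _ q)         = P p × Every P q
Every P p@(∧R _ q r)       = P p × Every P q × Every P r
Every P p@(∨L _ q r)       = P p × Every P q × Every P r
Every P p@(∨R₁ _ q)        = P p × Every P q
Every P p@(∨R₂ _ q)        = P p × Every P q
Every P p@(⊃L _ _ q r)     = P p × Every P q × Every P r
Every P p@(⊃R _ q)         = P p × Every P q
Every P p@(∀L _ _ q)       = P p × Every P q
Every P p@(∃R _ _ q)       = P p × Every P q
Every P p@(∃L _ _ _ q)     = P p × Every P q
Every P p@(∀R _ _ _ q)     = P p × Every P q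

IProof : Γ ⟶ Δ → Set
IProof = Every (λ {Γ} {Δ} _ → length Δ ≡ 1)

RIntro : Γ ⟶ Δ → Set
RIntro (∧R _ _ _)     = ⊤
RIntro (∨R₁ _ _)      = ⊤
RIntro (∨R₂ _ _)      = ⊤
RIntro (⊃R _ _)       = ⊤
RIntro (∃R _ _ _)     = ⊤
RIntro (∀R _ _ _ _)   = ⊤
RIntro _              = ⊥

NonCompound : Fm → Set
NonCompound ⊤'         = ⊤
NonCompound ⊥'         = ⊤
NonCompound (atom _ _) = ⊤
NonCompound _          = ⊥

-- uniform proof: an I-proof in which every sequent whose succedent is
-- compound is the conclusion of the rule introducing that symbol
-- (in an I-proof the succedent of an R-introduction is its principal formula)
Uniform : Γ ⟶ Δ → Set
Uniform p = IProof p × Every (λ {Γ} {Δ} q → RIntro q ⊎ All NonCompound Δ) p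

infix 2 _⊢C_ _⊢O_

_⊢C_ : List Fm → Fm → Set
Γ ⊢C B = Γ ⟶ B ∷ []

_⊢O_ : List Fm → Fm → Set
Γ ⊢O B = Σ (Γ ⟶ B ∷ []) Uniform

mutual
  data IsG {n : ℕ} : Formula n → Set where
    g⊤ : IsG ⊤'
    g⊥ : IsG ⊥'
    gA : ∀ {p ts} → IsG (atom p ts)
    g∧ : ∀ {B D} → IsG B → IsG D → IsG (B ∧' D)
    g∨ : ∀ {B D} → IsG B → IsG D → IsG (B ∨' D)
    g⊃ : ∀ {B D} → IsD B → IsG D → IsG (B ⊃' D)
    g∃ : ∀ {B} → IsG B → IsG (∃' B)

  data IsD {n : ℕ} : Formula n → Set where
    d⊤ : IsD ⊤'
    d⊥ : IsD ⊥'
    dA : ∀ {p ts} → IsD (atom p ts)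
    d⊃ : ∀ {B D} → IsG B → IsD D → IsD (B ⊃' D)
    d∧ : ∀ {B D} → IsD B → IsD D → IsD (B ∧' D)
    d∨ : ∀ {B D} → IsD B → IsD D → IsD (B ∨' D)
    d∃ : ∀ {B} → IsD B → IsD (∃' B)
    d∀ : ∀ {B} → IsD B → IsD (∀' B)

module Submission where

-- Right to left: in a C-proof of ¬G, Γ ⟶ G the left premise of every ⊃L on ¬G proves G, so the
-- copies of ¬G can be dropped from the antecedent at the price of one extra G in the succedent
-- (the right premise ⊥, … ⟶ Θ is replaced by weakening with Θ); the two G's are then contracted.
-- Left to right: a C-proof of Γ ⟶ Δ with D-formulas on the left and G-formulas on the right is
-- read as a uniform refutation: if each formula of Δ, once proved uniformly in an extension of
-- the context, leads to a uniform proof of ⊥, then the context proves ⊥ uniformly. Rule by rule,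
-- left rules become uniform left rules with goal ⊥ and right rules feed their uniform right rule
-- into the continuation of the principal formula; for ⊃R the premise is refuted first, and a
-- uniform proof of ⊥ proves every G-formula. For Δ = G the continuation is ⊃L on ¬G.

open import Defs
open import Data.List using (List; []; _∷_; _++_; _∷ʳ_; [_]; replicate)
open import Data.List.Relation.Unary.All as All using (All; []; _∷_)
open import Data.List.Relation.Unary.Any using (Any; here; there)
open import Data.List.Relation.Unary.Any.Properties using (++⁻)
open import Data.List.Relation.Unary.All.Properties using () renaming (++⁻ to All-++⁻)
open import Data.List.Membership.Propositional using (_∈_; lose)
open import Data.List.Membership.Propositional.Properties using (∈-∃++; ∈-++⁺ˡ; ∈-++⁻)
open import Data.List.Relation.Binary.Subset.Propositional using (_⊆_)
open import Data.List.Relation.Binary.Subset.Propositional.Properties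
  using (⊆-refl; ⊆-trans; ⊆-reflexive-↭; ⊆-respʳ-↭; ∷⁺ʳ; ∈-∷⁺ʳ; xs⊆x∷xs; xs⊆ys++xs; Any-resp-⊆)
open import Data.List.Relation.Binary.Permutation.Propositional
  using (_↭_; prep; ↭-sym; ↭-trans; ↭-refl; ↭-reflexive)
open import Data.List.Relation.Binary.Permutation.Propositional.Properties
  using (∈-resp-↭; Any-resp-↭; All-resp-↭; shift; drop-∷; ++⁺ˡ; ++⁺ʳ; ++-comm; ∷↭∷ʳ)
open import Data.List.Properties using (++-assoc)
open import Data.Nat using (ℕ; zero; suc; _≤_; _⊔_; s≤s; _+_; _≟_)
open import Data.Nat.Properties using (m≤m⊔n; m≤n⊔m; m≤m+n; m≤n+m; ≤-trans; ≤-refl; ≤-reflexive; 1+n≰n)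
open import Data.Fin using (Fin; zero; suc)
open import Data.Product using (∃-syntax; _×_; _,_; proj₁)
open import Data.Sum using (_⊎_; inj₁; inj₂)
open import Data.Unit using (tt)
open import Data.Empty using (⊥-elim)
open import Function using (_∘_; id)
open import Function.Bundles using (_⇔_; mk⇔)
open import Relation.Nullary using (¬_; yes; no)
open import Relation.Binary.PropositionalEquality using (_≡_; _≢_; refl; cong; cong₂; sym; trans; subst)

private variable
  Γ′ Γ₁ Γᵘ : List Fm
  E F H X : Fm
  c k : ℕ
  r : ℕ → ℕ

-- Renaming constants

mutual
  mapConstᵗ : ∀ {n} → (ℕ → ℕ) → Term n → Term n
  mapConstᵗ r (var i)          = var i
  mapConstᵗ r (fun c [])       = const (r c)
  mapConstᵗ r (fun f (t ∷ ts)) = fun f (mapConstˢ r (t ∷ ts))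

  mapConstˢ : ∀ {n} → (ℕ → ℕ) → List (Term n) → List (Term n)
  mapConstˢ r []       = []
  mapConstˢ r (t ∷ ts) = mapConstᵗ r t ∷ mapConstˢ r ts

mapConst : ∀ {n} → (ℕ → ℕ) → Formula n → Formula n
mapConst r ⊤'          = ⊤'
mapConst r ⊥'          = ⊥'
mapConst r (atom p ts) = atom p (mapConstˢ r ts)
mapConst r (B ∧' D)    = mapConst r B ∧' mapConst r D
mapConst r (B ∨' D)    = mapConst r B ∨' mapConst r D
mapConst r (B ⊃' D)    = mapConst r B ⊃' mapConst r D
mapConst r (∃' B)      = ∃' (mapConst r B)
mapConst r (∀' B)      = ∀' (mapConst r B)

mutual
  mapConstᵗ-ren : ∀ {m n} (ρ : Fin m → Fin n) (t : Term m) →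
                  mapConstᵗ r (ren ρ t) ≡ ren ρ (mapConstᵗ r t)
  mapConstᵗ-ren ρ (var i)          = refl
  mapConstᵗ-ren ρ (fun c [])       = refl
  mapConstᵗ-ren ρ (fun f (t ∷ ts)) = cong (fun f) (mapConstˢ-ren ρ (t ∷ ts))

  mapConstˢ-ren : ∀ {m n} (ρ : Fin m → Fin n) (ts : List (Term m)) →
                  mapConstˢ r (renL ρ ts) ≡ renL ρ (mapConstˢ r ts)
  mapConstˢ-ren ρ []       = refl
  mapConstˢ-ren ρ (t ∷ ts) = cong₂ _∷_ (mapConstᵗ-ren ρ t) (mapConstˢ-ren ρ ts)

mutual
  sub-cong : ∀ {m n} {σ τ : Fin m → Term n} → (∀ i → σ i ≡ τ i) →
             (t : Term m) → sub σ t ≡ sub τ t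
  sub-cong σ≗τ (var i)    = σ≗τ i
  sub-cong σ≗τ (fun f ts) = cong (fun f) (subL-cong σ≗τ ts)

  subL-cong : ∀ {m n} {σ τ : Fin m → Term n} → (∀ i → σ i ≡ τ i) →
              (ts : List (Term m)) → subL σ ts ≡ subL τ ts
  subL-cong σ≗τ []       = refl
  subL-cong σ≗τ (t ∷ ts) = cong₂ _∷_ (sub-cong σ≗τ t) (subL-cong σ≗τ ts)

lift-cong : ∀ {m n} {σ τ : Fin m → Term n} → (∀ i → σ i ≡ τ i) → ∀ i → lift σ i ≡ lift τ i
lift-cong σ≗τ zero    = refl
lift-cong σ≗τ (suc i) = cong (ren suc) (σ≗τ i)

substF-cong : ∀ {m n} {σ τ : Fin m → Term n} → (∀ i → σ i ≡ τ i) →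
              (B : Formula m) → substF σ B ≡ substF τ B
substF-cong σ≗τ ⊤'          = refl
substF-cong σ≗τ ⊥'          = refl
substF-cong σ≗τ (atom p ts) = cong (atom p) (subL-cong σ≗τ ts)
substF-cong σ≗τ (B ∧' D)    = cong₂ _∧'_ (substF-cong σ≗τ B) (substF-cong σ≗τ D)
substF-cong σ≗τ (B ∨' D)    = cong₂ _∨'_ (substF-cong σ≗τ B) (substF-cong σ≗τ D)
substF-cong σ≗τ (B ⊃' D)    = cong₂ _⊃'_ (substF-cong σ≗τ B) (substF-cong σ≗τ D)
substF-cong σ≗τ (∃' B)      = cong ∃' (substF-cong (lift-cong σ≗τ) B)
substF-cong σ≗τ (∀' B)      = cong ∀' (substF-cong (lift-cong σ≗τ) B)

mutual
  mapConstᵗ-sub : ∀ {m n} (σ : Fin m → Term n) (t : Term m) →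
                  mapConstᵗ r (sub σ t) ≡ sub (mapConstᵗ r ∘ σ) (mapConstᵗ r t)
  mapConstᵗ-sub σ (var i)          = refl
  mapConstᵗ-sub σ (fun c [])       = refl
  mapConstᵗ-sub σ (fun f (t ∷ ts)) = cong (fun f) (mapConstˢ-sub σ (t ∷ ts))

  mapConstˢ-sub : ∀ {m n} (σ : Fin m → Term n) (ts : List (Term m)) →
                  mapConstˢ r (subL σ ts) ≡ subL (mapConstᵗ r ∘ σ) (mapConstˢ r ts)
  mapConstˢ-sub σ []       = refl
  mapConstˢ-sub σ (t ∷ ts) = cong₂ _∷_ (mapConstᵗ-sub σ t) (mapConstˢ-sub σ ts)

mapConstᵗ-lift : ∀ {m n} (σ : Fin m → Term n) i →
                 mapConstᵗ r (lift σ i) ≡ lift (mapConstᵗ r ∘ σ) i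
mapConstᵗ-lift σ zero    = refl
mapConstᵗ-lift σ (suc i) = mapConstᵗ-ren suc (σ i)

mapConst-substF : ∀ {m n} (σ : Fin m → Term n) (B : Formula m) →
                  mapConst r (substF σ B) ≡ substF (mapConstᵗ r ∘ σ) (mapConst r B)
mapConst-substF σ ⊤'          = refl
mapConst-substF σ ⊥'          = refl
mapConst-substF σ (atom p ts) = cong (atom p) (mapConstˢ-sub σ ts)
mapConst-substF σ (B ∧' D)    = cong₂ _∧'_ (mapConst-substF σ B) (mapConst-substF σ D)
mapConst-substF σ (B ∨' D)    = cong₂ _∨'_ (mapConst-substF σ B) (mapConst-substF σ D)
mapConst-substF σ (B ⊃' D)    = cong₂ _⊃'_ (mapConst-substF σ B) (mapConst-substF σ D)
mapConst-substF {r = r} σ (∃' B) =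
  cong ∃' (trans (mapConst-substF (lift σ) B) (substF-cong (mapConstᵗ-lift σ) (mapConst r B)))
mapConst-substF {r = r} σ (∀' B) =
  cong ∀' (trans (mapConst-substF (lift σ) B) (substF-cong (mapConstᵗ-lift σ) (mapConst r B)))

mapConst-inst : (B : Formula 1) (t : Term 0) →
                mapConst r (inst B t) ≡ inst (mapConst r B) (mapConstᵗ r t)
mapConst-inst {r = r} B t =
  trans (mapConst-substF _ B) (substF-cong (λ { zero → refl ; (suc i) → refl }) (mapConst r B))

mutual
  mapConstᵗ-id : ∀ {n} (t : Term n) → mapConstᵗ id t ≡ t
  mapConstᵗ-id (var i)          = refl
  mapConstᵗ-id (fun c [])       = refl
  mapConstᵗ-id (fun f (t ∷ ts)) = cong (fun f) (mapConstˢ-id (t ∷ ts))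

  mapConstˢ-id : ∀ {n} (ts : List (Term n)) → mapConstˢ id ts ≡ ts
  mapConstˢ-id []       = refl
  mapConstˢ-id (t ∷ ts) = cong₂ _∷_ (mapConstᵗ-id t) (mapConstˢ-id ts)

mapConst-id : ∀ {n} (B : Formula n) → mapConst id B ≡ B
mapConst-id ⊤'          = refl
mapConst-id ⊥'          = refl
mapConst-id (atom p ts) = cong (atom p) (mapConstˢ-id ts)
mapConst-id (B ∧' D)    = cong₂ _∧'_ (mapConst-id B) (mapConst-id D)
mapConst-id (B ∨' D)    = cong₂ _∨'_ (mapConst-id B) (mapConst-id D)
mapConst-id (B ⊃' D)    = cong₂ _⊃'_ (mapConst-id B) (mapConst-id D)
mapConst-id (∃' B)      = cong ∃' (mapConst-id B)
mapConst-id (∀' B)      = cong ∀' (mapConst-id B)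

mutual
  mapConstᵗ-cong : ∀ {n} {r r′ : ℕ → ℕ} (t : Term n) →
                   (∀ c → OccT c t → r c ≡ r′ c) → mapConstᵗ r t ≡ mapConstᵗ r′ t
  mapConstᵗ-cong (var i)          _  = refl
  mapConstᵗ-cong (fun c [])       eq = cong const (eq c here)
  mapConstᵗ-cong (fun f (t ∷ ts)) eq = cong (fun f) (mapConstˢ-cong (t ∷ ts) (λ c → eq c ∘ inside))

  mapConstˢ-cong : ∀ {n} {r r′ : ℕ → ℕ} (ts : List (Term n)) →
                   (∀ c → Any (OccT c) ts → r c ≡ r′ c) → mapConstˢ r ts ≡ mapConstˢ r′ ts
  mapConstˢ-cong []       _  = refl
  mapConstˢ-cong (t ∷ ts) eq =
    cong₂ _∷_ (mapConstᵗ-cong t (λ c → eq c ∘ here)) (mapConstˢ-cong ts (λ c → eq c ∘ there))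

mapConst-cong : ∀ {n} {r r′ : ℕ → ℕ} (B : Formula n) →
                (∀ c → OccF c B → r c ≡ r′ c) → mapConst r B ≡ mapConst r′ B
mapConst-cong ⊤'          _  = refl
mapConst-cong ⊥'          _  = refl
mapConst-cong (atom p ts) eq = cong (atom p) (mapConstˢ-cong ts (λ c → eq c ∘ atomO))
mapConst-cong (B ∧' D)    eq =
  cong₂ _∧'_ (mapConst-cong B (λ c → eq c ∘ ∧O₁)) (mapConst-cong D (λ c → eq c ∘ ∧O₂))
mapConst-cong (B ∨' D)    eq =
  cong₂ _∨'_ (mapConst-cong B (λ c → eq c ∘ ∨O₁)) (mapConst-cong D (λ c → eq c ∘ ∨O₂))
mapConst-cong (B ⊃' D)    eq =
  cong₂ _⊃'_ (mapConst-cong B (λ c → eq c ∘ ⊃O₁)) (mapConst-cong D (λ c → eq c ∘ ⊃O₂))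
mapConst-cong (∃' B)      eq = cong ∃' (mapConst-cong B (λ c → eq c ∘ ∃O))
mapConst-cong (∀' B)      eq = cong ∀' (mapConst-cong B (λ c → eq c ∘ ∀O))

_[_↦_] : (ℕ → ℕ) → ℕ → ℕ → ℕ → ℕ
(r [ c ↦ c′ ]) x with x ≟ c
... | yes _ = c′
... | no  _ = r x

[↦]-≡ : ∀ r c c′ → (r [ c ↦ c′ ]) c ≡ c′
[↦]-≡ r c c′ with c ≟ c
... | yes _   = refl
... | no  c≢c = ⊥-elim (c≢c refl)

[↦]-≢ : ∀ r {c} c′ {x} → x ≢ c → (r [ c ↦ c′ ]) x ≡ r x
[↦]-≢ r {c} c′ {x} x≢c with x ≟ c
... | yes x≡c = ⊥-elim (x≢c x≡c)
... | no  _   = refl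

mapConst-[↦]-fresh : ∀ {n} r c′ (B : Formula n) → ¬ OccF c B → mapConst (r [ c ↦ c′ ]) B ≡ mapConst r B
mapConst-[↦]-fresh r c′ B c∉B = mapConst-cong B λ { x o → [↦]-≢ r c′ λ { refl → c∉B o } }

AtomOrBot-mapConst : ∀ r → AtomOrBot A → AtomOrBot (mapConst r A)
AtomOrBot-mapConst r isAtom = isAtom
AtomOrBot-mapConst r isBot  = isBot

mutual
  IsG-mapConst : ∀ {n} r {B : Formula n} → IsG B → IsG (mapConst r B)
  IsG-mapConst r g⊤       = g⊤
  IsG-mapConst r g⊥       = g⊥
  IsG-mapConst r gA       = gA
  IsG-mapConst r (g∧ b d) = g∧ (IsG-mapConst r b) (IsG-mapConst r d)
  IsG-mapConst r (g∨ b d) = g∨ (IsG-mapConst r b) (IsG-mapConst r d)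
  IsG-mapConst r (g⊃ b d) = g⊃ (IsD-mapConst r b) (IsG-mapConst r d)
  IsG-mapConst r (g∃ b)   = g∃ (IsG-mapConst r b)

  IsD-mapConst : ∀ {n} r {B : Formula n} → IsD B → IsD (mapConst r B)
  IsD-mapConst r d⊤       = d⊤
  IsD-mapConst r d⊥       = d⊥
  IsD-mapConst r dA       = dA
  IsD-mapConst r (d⊃ b d) = d⊃ (IsG-mapConst r b) (IsD-mapConst r d)
  IsD-mapConst r (d∧ b d) = d∧ (IsD-mapConst r b) (IsD-mapConst r d)
  IsD-mapConst r (d∨ b d) = d∨ (IsD-mapConst r b) (IsD-mapConst r d)
  IsD-mapConst r (d∃ b)   = d∃ (IsD-mapConst r b)
  IsD-mapConst r (d∀ b)   = d∀ (IsD-mapConst r b)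

mutual
  IsG-substF : ∀ {m n} (σ : Fin m → Term n) {B : Formula m} → IsG B → IsG (substF σ B)
  IsG-substF σ g⊤       = g⊤
  IsG-substF σ g⊥       = g⊥
  IsG-substF σ gA       = gA
  IsG-substF σ (g∧ b d) = g∧ (IsG-substF σ b) (IsG-substF σ d)
  IsG-substF σ (g∨ b d) = g∨ (IsG-substF σ b) (IsG-substF σ d)
  IsG-substF σ (g⊃ b d) = g⊃ (IsD-substF σ b) (IsG-substF σ d)
  IsG-substF σ (g∃ b)   = g∃ (IsG-substF (lift σ) b)

  IsD-substF : ∀ {m n} (σ : Fin m → Term n) {B : Formula m} → IsD B → IsD (substF σ B)
  IsD-substF σ d⊤       = d⊤
  IsD-substF σ d⊥       = d⊥
  IsD-substF σ dA       = dA
  IsD-substF σ (d⊃ b d) = d⊃ (IsG-substF σ b) (IsD-substF σ d)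
  IsD-substF σ (d∧ b d) = d∧ (IsD-substF σ b) (IsD-substF σ d)
  IsD-substF σ (d∨ b d) = d∨ (IsD-substF σ b) (IsD-substF σ d)
  IsD-substF σ (d∃ b)   = d∃ (IsD-substF (lift σ) b)
  IsD-substF σ (d∀ b)   = d∀ (IsD-substF (lift σ) b)

size : ∀ {n} → Formula n → ℕ
size ⊤'         = 0
size ⊥'         = 0
size (atom _ _) = 0
size (B ∧' D)   = suc (size B + size D)
size (B ∨' D)   = suc (size B + size D)
size (B ⊃' D)   = suc (size B + size D)
size (∃' B)     = suc (size B)
size (∀' B)     = suc (size B)

size-substF : ∀ {m n} (σ : Fin m → Term n) (B : Formula m) → size (substF σ B) ≡ size B
size-substF σ ⊤'          = refl
size-substF σ ⊥'          = refl
size-substF σ (atom p ts) = refl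
size-substF σ (B ∧' D)    = cong₂ (λ b d → suc (b + d)) (size-substF σ B) (size-substF σ D)
size-substF σ (B ∨' D)    = cong₂ (λ b d → suc (b + d)) (size-substF σ B) (size-substF σ D)
size-substF σ (B ⊃' D)    = cong₂ (λ b d → suc (b + d)) (size-substF σ B) (size-substF σ D)
size-substF σ (∃' B)      = cong suc (size-substF (lift σ) B)
size-substF σ (∀' B)      = cong suc (size-substF (lift σ) B)

-- Fresh constants

mutual
  maxConstᵗ : ∀ {n} → Term n → ℕ
  maxConstᵗ (var i)    = 0
  maxConstᵗ (fun f ts) = f ⊔ maxConstˢ ts

  maxConstˢ : ∀ {n} → List (Term n) → ℕ
  maxConstˢ []       = 0
  maxConstˢ (t ∷ ts) = maxConstᵗ t ⊔ maxConstˢ ts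

maxConst : ∀ {n} → Formula n → ℕ
maxConst ⊤'          = 0
maxConst ⊥'          = 0
maxConst (atom p ts) = maxConstˢ ts
maxConst (B ∧' D)    = maxConst B ⊔ maxConst D
maxConst (B ∨' D)    = maxConst B ⊔ maxConst D
maxConst (B ⊃' D)    = maxConst B ⊔ maxConst D
maxConst (∃' B)      = maxConst B
maxConst (∀' B)      = maxConst B

maxConsts : List Fm → ℕ
maxConsts []      = 0
maxConsts (F ∷ L) = maxConst F ⊔ maxConsts L

mutual
  OccT⇒≤maxConstᵗ : ∀ {n} {t : Term n} → OccT c t → c ≤ maxConstᵗ t
  OccT⇒≤maxConstᵗ {c = c} here       = m≤m⊔n c 0
  OccT⇒≤maxConstᵗ (inside {f} o)     = ≤-trans (Any-OccT⇒≤maxConstˢ o) (m≤n⊔m f _)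

  Any-OccT⇒≤maxConstˢ : ∀ {n} {ts : List (Term n)} → Any (OccT c) ts → c ≤ maxConstˢ ts
  Any-OccT⇒≤maxConstˢ (here o)  = ≤-trans (OccT⇒≤maxConstᵗ o) (m≤m⊔n _ _)
  Any-OccT⇒≤maxConstˢ (there o) = ≤-trans (Any-OccT⇒≤maxConstˢ o) (m≤n⊔m _ _)

OccF⇒≤maxConst : ∀ {n} {B : Formula n} → OccF c B → c ≤ maxConst B
OccF⇒≤maxConst (atomO o) = Any-OccT⇒≤maxConstˢ o
OccF⇒≤maxConst (∧O₁ o)   = ≤-trans (OccF⇒≤maxConst o) (m≤m⊔n _ _)
OccF⇒≤maxConst (∧O₂ o)   = ≤-trans (OccF⇒≤maxConst o) (m≤n⊔m _ _)
OccF⇒≤maxConst (∨O₁ o)   = ≤-trans (OccF⇒≤maxConst o) (m≤m⊔n _ _)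
OccF⇒≤maxConst (∨O₂ o)   = ≤-trans (OccF⇒≤maxConst o) (m≤n⊔m _ _)
OccF⇒≤maxConst (⊃O₁ o)   = ≤-trans (OccF⇒≤maxConst o) (m≤m⊔n _ _)
OccF⇒≤maxConst (⊃O₂ o)   = ≤-trans (OccF⇒≤maxConst o) (m≤n⊔m _ _)
OccF⇒≤maxConst (∃O o)    = OccF⇒≤maxConst o
OccF⇒≤maxConst (∀O o)    = OccF⇒≤maxConst o

Any-OccF⇒≤maxConsts : {L : List Fm} → Any (OccF c) L → c ≤ maxConsts L
Any-OccF⇒≤maxConsts (here o)  = ≤-trans (OccF⇒≤maxConst o) (m≤m⊔n _ _)
Any-OccF⇒≤maxConsts (there o) = ≤-trans (Any-OccF⇒≤maxConsts o) (m≤n⊔m _ _)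

suc-maxConsts-fresh : (L : List Fm) → ¬ Any (OccF (suc (maxConsts L))) L
suc-maxConsts-fresh L = 1+n≰n ∘ Any-OccF⇒≤maxConsts

∈⇒↭ : F ∈ Γ → ∃[ Γ₀ ] Γ ↭ F ∷ Γ₀
∈⇒↭ {F = F} m with Γ₁ , Γ₂ , refl ← ∈-∃++ m = Γ₁ ++ Γ₂ , shift F Γ₁ Γ₂

∉-∷ʳ : ¬ Any (OccF c) Δ → ¬ OccF c E → ¬ Any (OccF c) (Δ ∷ʳ E)
∉-∷ʳ {Δ = Δ} c∉Δ c∉E o with ++⁻ Δ o
... | inj₁ o∈Δ        = c∉Δ o∈Δ
... | inj₂ (here o∈E) = c∉E o∈E

⟶-↭ʳ : Γ ⟶ Δ → Δ ↭ Δ₁ → Γ ⟶ Δ₁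
⟶-↭ʳ (ax⊤ m)              σ = ax⊤ (∈-resp-↭ σ m)
⟶-↭ʳ (axA a m₁ m₂)        σ = axA a m₁ (∈-resp-↭ σ m₂)
⟶-↭ʳ (contrL p π)         σ = contrL p (⟶-↭ʳ π σ)
⟶-↭ʳ (contrR p π)         σ = contrR (↭-trans (↭-sym σ) p) π
⟶-↭ʳ (⊥R p π)             σ = ⊥R (↭-trans (↭-sym σ) p) π
⟶-↭ʳ (∧L p π)             σ = ∧L p (⟶-↭ʳ π σ)
⟶-↭ʳ (∧R p π₁ π₂)         σ = ∧R (↭-trans (↭-sym σ) p) π₁ π₂
⟶-↭ʳ (∨L p π₁ π₂)         σ = ∨L p (⟶-↭ʳ π₁ σ) (⟶-↭ʳ π₂ σ)
⟶-↭ʳ (∨R₁ p π)            σ = ∨R₁ (↭-trans (↭-sym σ) p) π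
⟶-↭ʳ (∨R₂ p π)            σ = ∨R₂ (↭-trans (↭-sym σ) p) π
⟶-↭ʳ (⊃L p q π₁ π₂)       σ = ⊃L p (↭-trans (↭-sym σ) q) π₁ π₂
⟶-↭ʳ (⊃R p π)             σ = ⊃R (↭-trans (↭-sym σ) p) π
⟶-↭ʳ (∀L p t π)           σ = ∀L p t (⟶-↭ʳ π σ)
⟶-↭ʳ (∃R p t π)           σ = ∃R (↭-trans (↭-sym σ) p) t π
⟶-↭ʳ (∃L p c (∉Γ , ∉Δ) π) σ = ∃L p c (∉Γ , ∉Δ ∘ Any-resp-↭ (↭-sym σ)) (⟶-↭ʳ π σ)
⟶-↭ʳ (∀R p c (∉Γ , ∉Δ) π) σ = ∀R (↭-trans (↭-sym σ) p) c (∉Γ , ∉Δ ∘ Any-resp-↭ (↭-sym σ)) π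

-- Weakening goes through ⊥', which contains no constant and so respects every eigenvariable
-- condition; ⊥R then turns it into any formula.
⟶-weaken-⊥ : Γ ⟶ Δ → Γ ⟶ Δ ∷ʳ ⊥'
⟶-weaken-⊥ (ax⊤ m)              = ax⊤ (∈-++⁺ˡ m)
⟶-weaken-⊥ (axA a m₁ m₂)        = axA a m₁ (∈-++⁺ˡ m₂)
⟶-weaken-⊥ (contrL p π)         = contrL p (⟶-weaken-⊥ π)
⟶-weaken-⊥ (contrR p π)         = contrR (++⁺ʳ _ p) (⟶-weaken-⊥ π)
⟶-weaken-⊥ (⊥R p π)             = ⊥R (++⁺ʳ _ p) (⟶-weaken-⊥ π)
⟶-weaken-⊥ (∧L p π)             = ∧L p (⟶-weaken-⊥ π)
⟶-weaken-⊥ (∧R p π₁ π₂)         = ∧R (++⁺ʳ _ p) (⟶-weaken-⊥ π₁) (⟶-weaken-⊥ π₂)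
⟶-weaken-⊥ (∨L p π₁ π₂)         = ∨L p (⟶-weaken-⊥ π₁) (⟶-weaken-⊥ π₂)
⟶-weaken-⊥ (∨R₁ p π)            = ∨R₁ (++⁺ʳ _ p) (⟶-weaken-⊥ π)
⟶-weaken-⊥ (∨R₂ p π)            = ∨R₂ (++⁺ʳ _ p) (⟶-weaken-⊥ π)
⟶-weaken-⊥ (⊃L {Δ₁ = Δ₁} p q π₁ π₂) =
  ⊃L p (↭-trans (++⁺ʳ _ q) (↭-reflexive (++-assoc Δ₁ _ _))) π₁ (⟶-weaken-⊥ π₂)
⟶-weaken-⊥ (⊃R p π)             = ⊃R (++⁺ʳ _ p) (⟶-weaken-⊥ π)
⟶-weaken-⊥ (∀L p t π)           = ∀L p t (⟶-weaken-⊥ π)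
⟶-weaken-⊥ (∃R p t π)           = ∃R (++⁺ʳ _ p) t (⟶-weaken-⊥ π)
⟶-weaken-⊥ (∃L p c (∉Γ , ∉Δ) π) = ∃L p c (∉Γ , ∉-∷ʳ ∉Δ λ ()) (⟶-weaken-⊥ π)
⟶-weaken-⊥ (∀R p c (∉Γ , ∉Δ) π) = ∀R (++⁺ʳ _ p) c (∉Γ , ∉-∷ʳ ∉Δ λ ()) (⟶-weaken-⊥ π)

⟶-weaken : ∀ D → Γ ⟶ Δ → Γ ⟶ D ∷ Δ
⟶-weaken {Δ = Δ} D π = ⊥R ↭-refl (⟶-↭ʳ (⟶-weaken-⊥ π) (↭-sym (∷↭∷ʳ ⊥' Δ)))

⟶-weaken-++ : ∀ Θ → Γ ⟶ Δ → Γ ⟶ Θ ++ Δ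
⟶-weaken-++ []      π = π
⟶-weaken-++ (D ∷ Θ) π = ⟶-weaken D (⟶-weaken-++ Θ π)

∈-replicate⁻ : F ∈ replicate k E → F ≡ E
∈-replicate⁻ {k = suc k} (here refl) = refl
∈-replicate⁻ {k = suc k} (there m)   = ∈-replicate⁻ m

∷ʳ-++ : ∀ (xs ys : List Fm) x → (xs ∷ʳ x) ++ ys ↭ x ∷ xs ++ ys
∷ʳ-++ xs ys x = ↭-trans (↭-reflexive (++-assoc xs [ x ] ys)) (shift x xs ys)

∷ʳ-++-∷ʳ : ∀ (xs ys : List Fm) x → (xs ∷ʳ x) ++ (ys ∷ʳ x) ↭ x ∷ x ∷ xs ++ ys
∷ʳ-++-∷ʳ xs ys x = ↭-trans (∷ʳ-++ xs (ys ∷ʳ x) x)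
  (prep x (↭-trans (↭-reflexive (sym (++-assoc xs ys [ x ]))) (↭-sym (∷↭∷ʳ x (xs ++ ys)))))

∷ʳ-↭-∷ : ∀ x → Δ ↭ Δ₁ → Δ ∷ʳ x ↭ x ∷ Δ₁
∷ʳ-↭-∷ {Δ = Δ} x σ = ↭-trans (↭-sym (∷↭∷ʳ x Δ)) (prep x σ)

-- Discharging ¬G

¬' : Fm → Fm
¬' G = G ⊃' ⊥'

module Discharge (G : Fm) where

  ¬Gs : ℕ → List Fm
  ¬Gs k = replicate (suc k) (¬' G)

  -- At least one copy, so that a constant fresh for Γ′ is fresh for G.
  infix 4 _≅_+¬G
  _≅_+¬G : List Fm → List Fm → Set
  Γ′ ≅ Γ +¬G = ∃[ k ] Γ′ ↭ ¬Gs k ++ Γ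

  ≅+¬G-∷ : Γ₁ ≅ Γ₀ +¬G → ∀ E → E ∷ Γ₁ ≅ E ∷ Γ₀ +¬G
  ≅+¬G-∷ {Γ₀ = Γ₀} (k , σ) E = k , ↭-trans (prep E σ) (↭-sym (shift E (¬Gs k) Γ₀))

  ≅+¬G-↭ : Γ′ ↭ Γ₁ → Γ′ ≅ Γ +¬G → Γ₁ ≅ Γ +¬G
  ≅+¬G-↭ τ (k , σ) = k , ↭-trans (↭-sym τ) σ

  ≅+¬G-suc : Γ′ ≅ Γ +¬G → ¬' G ∷ Γ′ ≅ Γ +¬G
  ≅+¬G-suc (k , σ) = suc k , prep _ σ

  locate : Γ′ ↭ F ∷ Γ₁ → Γ′ ≅ Γ +¬G → F ≡ ¬' G ⊎ ∃[ Γ₀ ] (Γ ↭ F ∷ Γ₀ × Γ₁ ≅ Γ₀ +¬G)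
  locate {F = F} {Γ₁ = Γ₁} p (k , σ) with ∈-++⁻ (¬Gs k) (∈-resp-↭ σ (∈-resp-↭ (↭-sym p) (here refl)))
  ... | inj₁ m = inj₁ (∈-replicate⁻ m)
  ... | inj₂ m with Γ₀ , q ← ∈⇒↭ m = inj₂ (Γ₀ , q , k , drop-∷ F∷Γ₁↭)
    where
    F∷Γ₁↭ : F ∷ Γ₁ ↭ F ∷ ¬Gs k ++ Γ₀
    F∷Γ₁↭ = ↭-trans (↭-sym p) (↭-trans σ (↭-trans (++⁺ˡ (¬Gs k) q) (shift F (¬Gs k) Γ₀)))

  fresh : Γ′ ≅ Γ +¬G → Fresh c Γ′ Δ → Fresh c Γ (Δ ∷ʳ G)
  fresh (k , σ) (∉Γ′ , ∉Δ) =
    ∉Γ′ ∘ Any-resp-⊆ (⊆-trans (xs⊆ys++xs _ (¬Gs k)) (⊆-reflexive-↭ (↭-sym σ))) ,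
    ∉-∷ʳ ∉Δ (λ o → ∉Γ′ (Any-resp-↭ (↭-sym σ) (here (⊃O₁ o))))

  discharge : Γ′ ⟶ Δ → Γ′ ≅ Γ +¬G → Γ ⟶ Δ ∷ʳ G
  discharge (ax⊤ m) σ = ax⊤ (∈-++⁺ˡ m)
  discharge (axA a m₁ m₂) (k , σ) with ∈-++⁻ (¬Gs k) (∈-resp-↭ σ m₁)
  ... | inj₁ m with refl ← ∈-replicate⁻ m with () ← a
  ... | inj₂ m = axA a m (∈-++⁺ˡ m₂)
  discharge (contrL {B = B} p π) σ with locate p σ
  ... | inj₁ refl              = discharge π (≅+¬G-suc (≅+¬G-↭ p σ))
  ... | inj₂ (Γ₀ , q , σ₀)     = contrL q (discharge π (≅+¬G-∷ (≅+¬G-∷ σ₀ B) B))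
  discharge (contrR p π)     σ = contrR (++⁺ʳ _ p) (discharge π σ)
  discharge (⊥R p π)         σ = ⊥R (++⁺ʳ _ p) (discharge π σ)
  discharge (∧L {B = B} {D = D} p π) σ with locate p σ
  ... | inj₂ (Γ₀ , q , σ₀)     = ∧L q (discharge π (≅+¬G-∷ (≅+¬G-∷ (≅+¬G-∷ σ₀ _) D) B))
  discharge (∧R p π₁ π₂)     σ = ∧R (++⁺ʳ _ p) (discharge π₁ σ) (discharge π₂ σ)
  discharge (∨L {B = B} {D = D} p π₁ π₂) σ with locate p σ
  ... | inj₂ (Γ₀ , q , σ₀)     = ∨L q (discharge π₁ (≅+¬G-∷ σ₀ B)) (discharge π₂ (≅+¬G-∷ σ₀ D))
  discharge (∨R₁ p π)        σ = ∨R₁ (++⁺ʳ _ p) (discharge π σ)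
  discharge (∨R₂ p π)        σ = ∨R₂ (++⁺ʳ _ p) (discharge π σ)
  discharge (⊃L {D = D} {Δ₁ = Δ₁} {Θ = Θ} p q π₁ π₂) σ with locate p σ
  ... | inj₁ refl =
    contrR (∷ʳ-↭-∷ G q)
           (⟶-↭ʳ (⟶-weaken-++ Θ (discharge π₁ (≅+¬G-↭ p σ)))
                 (↭-trans (++-comm Θ _) (prep G (∷ʳ-++ Δ₁ Θ G))))
  ... | inj₂ (Γ₀ , p₀ , σ₀) =
    contrR (∷ʳ-↭-∷ G q)
           (⊃L p₀ (↭-sym (∷ʳ-++-∷ʳ Δ₁ Θ G)) (discharge π₁ (≅+¬G-∷ σ₀ _)) (discharge π₂ (≅+¬G-∷ σ₀ D)))
  discharge (⊃R {B = B} p π) σ = ⊃R (++⁺ʳ _ p) (discharge π (≅+¬G-∷ σ B))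
  discharge (∀L p t π) σ with locate p σ
  ... | inj₂ (Γ₀ , q , σ₀)     = ∀L q t (discharge π (≅+¬G-∷ (≅+¬G-∷ σ₀ _) _))
  discharge (∃R p t π)       σ = ∃R (++⁺ʳ _ p) t (discharge π σ)
  discharge (∃L p c fr π) σ with locate p σ
  ... | inj₂ (Γ₀ , q , σ₀)     = ∃L q c (fresh σ fr) (discharge π (≅+¬G-∷ σ₀ _))
  discharge (∀R p c fr π)    σ = ∀R (++⁺ʳ _ p) c (fresh σ fr) (discharge π σ)

discharge-¬' : ∀ G → ¬' G ∷ Γ ⟶ G ∷ [] → Γ ⊢C G
discharge-¬' G π = contrR ↭-refl (Discharge.discharge G π (0 , ↭-refl))

O-⊤R : Γ ⊢O ⊤'
O-⊤R = ax⊤ (here refl) , refl , inj₂ (tt ∷ [])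

O-ax : AtomOrBot A → A ∈ Γ → Γ ⊢O A
O-ax isAtom m = axA isAtom m (here refl) , refl , inj₂ (tt ∷ [])
O-ax isBot  m = axA isBot  m (here refl) , refl , inj₂ (tt ∷ [])

O-∧R : Γ ⊢O B → Γ ⊢O D → Γ ⊢O B ∧' D
O-∧R (π₁ , i₁ , e₁) (π₂ , i₂ , e₂) = ∧R ↭-refl π₁ π₂ , (refl , i₁ , i₂) , (inj₁ tt , e₁ , e₂)

O-∨R₁ : Γ ⊢O B → Γ ⊢O B ∨' D
O-∨R₁ (π , i , e) = ∨R₁ ↭-refl π , (refl , i) , (inj₁ tt , e)

O-∨R₂ : Γ ⊢O D → Γ ⊢O B ∨' D
O-∨R₂ (π , i , e) = ∨R₂ ↭-refl π , (refl , i) , (inj₁ tt , e)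

O-⊃R : B ∷ Γ ⊢O D → Γ ⊢O B ⊃' D
O-⊃R (π , i , e) = ⊃R ↭-refl π , (refl , i) , (inj₁ tt , e)

O-∃R : (t : Term 0) → Γ ⊢O inst B₁ t → Γ ⊢O ∃' B₁
O-∃R t (π , i , e) = ∃R ↭-refl t π , (refl , i) , (inj₁ tt , e)

O-⊥R : NonCompound X → Γ ⊢O ⊥' → Γ ⊢O X
O-⊥R x (π , i , e) = ⊥R ↭-refl π , (refl , i) , (inj₂ (x ∷ []) , e)

O-contract : NonCompound X → F ∈ Γ → (∀ {Γ₀} → Γ ↭ Γ₀ → F ∷ Γ₀ ⊢O X) → Γ ⊢O X
O-contract x m k with Γ₀ , p ← ∈⇒↭ m with π , i , e ← k p =
  contrL p π , (refl , i) , (inj₂ (x ∷ []) , e)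

O-∧L : NonCompound X → B ∷ D ∷ (B ∧' D) ∷ Γ ⊢O X → (B ∧' D) ∷ Γ ⊢O X
O-∧L x (π , i , e) = ∧L ↭-refl π , (refl , i) , (inj₂ (x ∷ []) , e)

O-∨L : NonCompound X → B ∷ Γ ⊢O X → D ∷ Γ ⊢O X → (B ∨' D) ∷ Γ ⊢O X
O-∨L x (π₁ , i₁ , e₁) (π₂ , i₂ , e₂) = ∨L ↭-refl π₁ π₂ , (refl , i₁ , i₂) , (inj₂ (x ∷ []) , e₁ , e₂)

O-⊃L : NonCompound X → (B ⊃' D) ∷ Γ ⊢O B → D ∷ Γ ⊢O X → (B ⊃' D) ∷ Γ ⊢O X
O-⊃L x (π₁ , i₁ , e₁) (π₂ , i₂ , e₂) =
  ⊃L {Δ₁ = []} ↭-refl ↭-refl π₁ π₂ , (refl , i₁ , i₂) , (inj₂ (x ∷ []) , e₁ , e₂)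

O-∀L : NonCompound X → (t : Term 0) → inst B₁ t ∷ ∀' B₁ ∷ Γ ⊢O X → ∀' B₁ ∷ Γ ⊢O X
O-∀L x t (π , i , e) = ∀L ↭-refl t π , (refl , i) , (inj₂ (x ∷ []) , e)

O-∃L : NonCompound X → Fresh c (∃' B₁ ∷ Γ) (X ∷ []) → inst B₁ (const c) ∷ Γ ⊢O X → ∃' B₁ ∷ Γ ⊢O X
O-∃L {c = c} x fr (π , i , e) = ∃L ↭-refl c fr π , (refl , i) , (inj₂ (x ∷ []) , e)

infix 3 _⊢ᵘ_

data _⊢ᵘ_ : List Fm → Fm → Set where
  u⊤R  : Γ ⊢ᵘ ⊤'
  uax  : AtomOrBot A → A ∈ Γ → Γ ⊢ᵘ A
  u∧R  : Γ ⊢ᵘ B → Γ ⊢ᵘ D → Γ ⊢ᵘ B ∧' D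
  u∨R₁ : Γ ⊢ᵘ B → Γ ⊢ᵘ B ∨' D
  u∨R₂ : Γ ⊢ᵘ D → Γ ⊢ᵘ B ∨' D
  u⊃R  : B ∷ Γ ⊢ᵘ D → Γ ⊢ᵘ B ⊃' D
  u∃R  : (t : Term 0) → Γ ⊢ᵘ inst B₁ t → Γ ⊢ᵘ ∃' B₁
  u⊥R  : NonCompound X → Γ ⊢ᵘ ⊥' → Γ ⊢ᵘ X
  u∧L  : NonCompound X → (B ∧' D) ∈ Γ → B ∷ D ∷ Γ ⊢ᵘ X → Γ ⊢ᵘ X
  u∨L  : NonCompound X → (B ∨' D) ∈ Γ → B ∷ Γ ⊢ᵘ X → D ∷ Γ ⊢ᵘ X → Γ ⊢ᵘ X
  u⊃L  : NonCompound X → (B ⊃' D) ∈ Γ → Γ ⊢ᵘ B → D ∷ Γ ⊢ᵘ X → Γ ⊢ᵘ X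
  u∀L  : NonCompound X → ∀' B₁ ∈ Γ → (t : Term 0) → inst B₁ t ∷ Γ ⊢ᵘ X → Γ ⊢ᵘ X
  u∃L  : NonCompound X → ∃' B₁ ∈ Γ → (∀ c → inst B₁ (const c) ∷ Γ ⊢ᵘ X) → Γ ⊢ᵘ X

⊢ᵘ-mono : Γ ⊆ Γ′ → Γ ⊢ᵘ X → Γ′ ⊢ᵘ X
⊢ᵘ-mono s u⊤R               = u⊤R
⊢ᵘ-mono s (uax a m)         = uax a (s m)
⊢ᵘ-mono s (u∧R u₁ u₂)       = u∧R (⊢ᵘ-mono s u₁) (⊢ᵘ-mono s u₂)
⊢ᵘ-mono s (u∨R₁ u)          = u∨R₁ (⊢ᵘ-mono s u)
⊢ᵘ-mono s (u∨R₂ u)          = u∨R₂ (⊢ᵘ-mono s u)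
⊢ᵘ-mono s (u⊃R u)           = u⊃R (⊢ᵘ-mono (∷⁺ʳ _ s) u)
⊢ᵘ-mono s (u∃R t u)         = u∃R t (⊢ᵘ-mono s u)
⊢ᵘ-mono s (u⊥R x u)         = u⊥R x (⊢ᵘ-mono s u)
⊢ᵘ-mono s (u∧L x m u)       = u∧L x (s m) (⊢ᵘ-mono (∷⁺ʳ _ (∷⁺ʳ _ s)) u)
⊢ᵘ-mono s (u∨L x m u₁ u₂)   = u∨L x (s m) (⊢ᵘ-mono (∷⁺ʳ _ s) u₁) (⊢ᵘ-mono (∷⁺ʳ _ s) u₂)
⊢ᵘ-mono s (u⊃L x m u₁ u₂)   = u⊃L x (s m) (⊢ᵘ-mono s u₁) (⊢ᵘ-mono (∷⁺ʳ _ s) u₂)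
⊢ᵘ-mono s (u∀L x m t u)     = u∀L x (s m) t (⊢ᵘ-mono (∷⁺ʳ _ s) u)
⊢ᵘ-mono s (u∃L x m u)       = u∃L x (s m) (λ c → ⊢ᵘ-mono (∷⁺ʳ _ s) (u c))

⊆-↭-there : Γ ⊆ Γ′ → Γ′ ↭ Γ₀ → Γ ⊆ F ∷ Γ₀
⊆-↭-there s p = xs⊆x∷xs _ _ ∘ ⊆-respʳ-↭ p s

⊢ᵘ⇒⊢O : Γ ⊢ᵘ X → Γ ⊆ Γ′ → Γ′ ⊢O X
⊢ᵘ⇒⊢O u⊤R             s = O-⊤R
⊢ᵘ⇒⊢O (uax a m)       s = O-ax a (s m)
⊢ᵘ⇒⊢O (u∧R u₁ u₂)     s = O-∧R (⊢ᵘ⇒⊢O u₁ s) (⊢ᵘ⇒⊢O u₂ s)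
⊢ᵘ⇒⊢O (u∨R₁ u)        s = O-∨R₁ (⊢ᵘ⇒⊢O u s)
⊢ᵘ⇒⊢O (u∨R₂ u)        s = O-∨R₂ (⊢ᵘ⇒⊢O u s)
⊢ᵘ⇒⊢O (u⊃R u)         s = O-⊃R (⊢ᵘ⇒⊢O u (∷⁺ʳ _ s))
⊢ᵘ⇒⊢O (u∃R t u)       s = O-∃R t (⊢ᵘ⇒⊢O u s)
⊢ᵘ⇒⊢O (u⊥R x u)       s = O-⊥R x (⊢ᵘ⇒⊢O u s)
⊢ᵘ⇒⊢O (u∧L x m u)     s = O-contract x (s m) λ p →
  O-∧L x (⊢ᵘ⇒⊢O u (∷⁺ʳ _ (∷⁺ʳ _ (⊆-↭-there s p))))
⊢ᵘ⇒⊢O (u∨L x m u₁ u₂) s = O-contract x (s m) λ p →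
  O-∨L x (⊢ᵘ⇒⊢O u₁ (∷⁺ʳ _ (⊆-respʳ-↭ p s))) (⊢ᵘ⇒⊢O u₂ (∷⁺ʳ _ (⊆-respʳ-↭ p s)))
⊢ᵘ⇒⊢O (u⊃L x m u₁ u₂) s = O-contract x (s m) λ p →
  O-⊃L x (⊢ᵘ⇒⊢O u₁ (⊆-↭-there s p)) (⊢ᵘ⇒⊢O u₂ (∷⁺ʳ _ (⊆-respʳ-↭ p s)))
⊢ᵘ⇒⊢O (u∀L x m t u)   s = O-contract x (s m) λ p →
  O-∀L x t (⊢ᵘ⇒⊢O u (∷⁺ʳ _ (⊆-↭-there s p)))
⊢ᵘ⇒⊢O {X = X} {Γ′ = Γ′} (u∃L x m u) s = O-contract x (s m) λ p →
  O-∃L x (fresh p) (⊢ᵘ⇒⊢O (u new) (∷⁺ʳ _ (⊆-respʳ-↭ p s)))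
  where
  new : ℕ
  new = suc (maxConsts (X ∷ Γ′))
  fresh : Γ′ ↭ Γ₀ → Fresh new (_ ∷ Γ₀) (X ∷ [])
  fresh p =
    suc-maxConsts-fresh (X ∷ Γ′) ∘ Any-resp-⊆ (xs⊆x∷xs Γ′ X ∘ ∈-∷⁺ʳ (s m) (⊆-reflexive-↭ (↭-sym p))) ,
    suc-maxConsts-fresh (X ∷ Γ′) ∘ Any-resp-⊆ (λ { (here refl) → here refl })

-- Recursion on a size bound, since an instance of an ∃-body is not a subterm.
exFalso : IsG H → Γ ⊢ᵘ ⊥' → Γ ⊢ᵘ H
exFalso {H = H} gH = go (size H) gH ≤-refl
  where
  go : ∀ {Γ H} n → IsG H → size H ≤ n → Γ ⊢ᵘ ⊥' → Γ ⊢ᵘ H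
  go n       g⊤         _        u = u⊤R
  go n       g⊥         _        u = u
  go n       gA         _        u = u⊥R tt u
  go (suc n) (g∧ gB gD) (s≤s le) u =
    u∧R (go n gB (≤-trans (m≤m+n _ _) le) u) (go n gD (≤-trans (m≤n+m _ _) le) u)
  go (suc n) (g∨ gB _)  (s≤s le) u = u∨R₁ (go n gB (≤-trans (m≤m+n _ _) le) u)
  go (suc n) (g⊃ _ gD)  (s≤s le) u =
    u⊃R (go n gD (≤-trans (m≤n+m _ _) le) (⊢ᵘ-mono (xs⊆x∷xs _ _) u))
  go (suc n) (g∃ {B} gB) (s≤s le) u =
    u∃R (const 0) (go n (IsG-substF _ gB) (≤-trans (≤-reflexive (size-substF _ B)) le) u)

-- Classical proofs as uniform refutations

Refutes : (ℕ → ℕ) → List Fm → Fm → Set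
Refutes r Γᵘ H = ∀ {Γ′} → Γᵘ ⊆ Γ′ → Γ′ ⊢ᵘ mapConst r H → Γ′ ⊢ᵘ ⊥'

infix 4 _⊆⟨_⟩_
_⊆⟨_⟩_ : List Fm → (ℕ → ℕ) → List Fm → Set
Γ ⊆⟨ r ⟩ Γᵘ = ∀ {F} → F ∈ Γ → mapConst r F ∈ Γᵘ

Refutes-mono : Γᵘ ⊆ Γ′ → Refutes r Γᵘ H → Refutes r Γ′ H
Refutes-mono s k s′ = k (⊆-trans s s′)

Refutes-[↦] : ∀ c′ → ¬ OccF c H → Refutes r Γᵘ H → Refutes (r [ c ↦ c′ ]) Γᵘ H
Refutes-[↦] {H = H} {r = r} c′ c∉H k s u = k s (subst (_ ⊢ᵘ_) (mapConst-[↦]-fresh r c′ H c∉H) u)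

⊆⟨⟩-↭ : Γ ↭ F ∷ Γ₀ → Γ ⊆⟨ r ⟩ Γᵘ → F ∷ Γ₀ ⊆⟨ r ⟩ Γᵘ
⊆⟨⟩-↭ p h = h ∘ ∈-resp-↭ (↭-sym p)

⊆⟨⟩-∷ : mapConst r F ≡ E → Γ ⊆⟨ r ⟩ Γᵘ → F ∷ Γ ⊆⟨ r ⟩ E ∷ Γᵘ
⊆⟨⟩-∷ refl h (here refl) = here refl
⊆⟨⟩-∷ eq   h (there m)   = there (h m)

⊆⟨⟩-[↦] : ∀ c′ → ¬ Any (OccF c) Γ → Γ ⊆⟨ r ⟩ Γᵘ → Γ ⊆⟨ r [ c ↦ c′ ] ⟩ Γᵘ
⊆⟨⟩-[↦] {r = r} c′ c∉Γ h {F} m = subst (_∈ _) (sym (mapConst-[↦]-fresh r c′ F (c∉Γ ∘ lose m))) (h m)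

-- r renames the eigenvariables of the classical proof: this is how its ∃L is matched with u∃L.
refute : Γ ⟶ Δ → All IsD Γ → All IsG Δ → Γ ⊆⟨ r ⟩ Γᵘ → All (Refutes r Γᵘ) Δ → Γᵘ ⊢ᵘ ⊥'
refute (ax⊤ m) dΓ gΔ h k = All.lookup k m ⊆-refl u⊤R
refute {r = r} (axA a m₁ m₂) dΓ gΔ h k = All.lookup k m₂ ⊆-refl (uax (AtomOrBot-mapConst r a) (h m₁))
refute (contrL p π) dΓ gΔ h k with dB ∷ dΓ₀ ← All-resp-↭ p dΓ =
  refute π (dB ∷ dB ∷ dΓ₀) gΔ (h′ ∘ ∈-∷⁺ʳ (here refl) ⊆-refl) k
  where h′ = ⊆⟨⟩-↭ p h
refute (contrR p π) dΓ gΔ h k with gB ∷ gΔ₀ ← All-resp-↭ p gΔ | kB ∷ kΔ₀ ← All-resp-↭ p k =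
  refute π dΓ (gB ∷ gB ∷ gΔ₀) h (kB ∷ kB ∷ kΔ₀)
refute (⊥R p π) dΓ gΔ h k with _ ∷ gΔ₀ ← All-resp-↭ p gΔ | _ ∷ kΔ₀ ← All-resp-↭ p k =
  refute π dΓ (g⊥ ∷ gΔ₀) h ((λ _ u → u) ∷ kΔ₀)
refute (∧L p π) dΓ gΔ h k with d∧ dB dD ∷ dΓ₀ ← All-resp-↭ p dΓ =
  u∧L tt (h′ (here refl))
    (refute π (dB ∷ dD ∷ d∧ dB dD ∷ dΓ₀) gΔ (⊆⟨⟩-∷ refl (⊆⟨⟩-∷ refl h′))
            (All.map (Refutes-mono (xs⊆x∷xs _ _ ∘ xs⊆x∷xs _ _)) k))
  where h′ = ⊆⟨⟩-↭ p h
refute (∧R p π₁ π₂) dΓ gΔ h k with g∧ gB gD ∷ gΔ₀ ← All-resp-↭ p gΔ | kBD ∷ kΔ₀ ← All-resp-↭ p k =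
  refute π₁ dΓ (gB ∷ gΔ₀) h (kB ∷ kΔ₀)
  where
  kB : Refutes _ _ _
  kB s u = refute π₂ dΓ (gD ∷ gΔ₀) (s ∘ h) (kD ∷ All.map (Refutes-mono s) kΔ₀)
    where
    kD : Refutes _ _ _
    kD s′ u′ = kBD (⊆-trans s s′) (u∧R (⊢ᵘ-mono s′ u) u′)
refute (∨L p π₁ π₂) dΓ gΔ h k with d∨ dB dD ∷ dΓ₀ ← All-resp-↭ p dΓ =
  u∨L tt (h′ (here refl))
    (refute π₁ (dB ∷ dΓ₀) gΔ (⊆⟨⟩-∷ refl (h′ ∘ there)) (All.map (Refutes-mono (xs⊆x∷xs _ _)) k))
    (refute π₂ (dD ∷ dΓ₀) gΔ (⊆⟨⟩-∷ refl (h′ ∘ there)) (All.map (Refutes-mono (xs⊆x∷xs _ _)) k))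
  where h′ = ⊆⟨⟩-↭ p h
refute (∨R₁ p π) dΓ gΔ h k with g∨ gB _ ∷ gΔ₀ ← All-resp-↭ p gΔ | kBD ∷ kΔ₀ ← All-resp-↭ p k =
  refute π dΓ (gB ∷ gΔ₀) h ((λ s u → kBD s (u∨R₁ u)) ∷ kΔ₀)
refute (∨R₂ p π) dΓ gΔ h k with g∨ _ gD ∷ gΔ₀ ← All-resp-↭ p gΔ | kBD ∷ kΔ₀ ← All-resp-↭ p k =
  refute π dΓ (gD ∷ gΔ₀) h ((λ s u → kBD s (u∨R₂ u)) ∷ kΔ₀)
refute (⊃L {Δ₁ = Δ₁} p q π₁ π₂) dΓ gΔ h k
  with d⊃ gB dD ∷ dΓ₀ ← All-resp-↭ p dΓ
     | gΔ₁ , gΘ ← All-++⁻ Δ₁ (All-resp-↭ q gΔ)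
     | kΔ₁ , kΘ ← All-++⁻ Δ₁ (All-resp-↭ q k) =
  refute π₁ (d⊃ gB dD ∷ dΓ₀) (gB ∷ gΔ₁) h′ (kB ∷ kΔ₁)
  where
  h′ = ⊆⟨⟩-↭ p h
  kB : Refutes _ _ _
  kB s u = u⊃L tt (s (h′ (here refl))) u
             (refute π₂ (dD ∷ dΓ₀) gΘ (⊆⟨⟩-∷ refl (s ∘ h′ ∘ there))
                     (All.map (Refutes-mono (xs⊆x∷xs _ _ ∘ s)) kΘ))
refute {r = r} (⊃R p π) dΓ gΔ h k with g⊃ dB gD ∷ gΔ₀ ← All-resp-↭ p gΔ | kBD ∷ kΔ₀ ← All-resp-↭ p k =
  kBD ⊆-refl (u⊃R (exFalso (IsG-mapConst r gD)
    (refute π (dB ∷ dΓ) (gD ∷ gΔ₀) (⊆⟨⟩-∷ refl h) (kD ∷ All.map (Refutes-mono (xs⊆x∷xs _ _)) kΔ₀))))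
  where
  kD : Refutes _ _ _
  kD s u = kBD (s ∘ there) (u⊃R (⊢ᵘ-mono (xs⊆x∷xs _ _) u))
refute {r = r} (∀L {B₁ = B} p t π) dΓ gΔ h k with d∀ dB ∷ dΓ₀ ← All-resp-↭ p dΓ =
  u∀L tt (h′ (here refl)) (mapConstᵗ r t)
    (refute π (IsD-substF _ dB ∷ d∀ dB ∷ dΓ₀) gΔ (⊆⟨⟩-∷ (mapConst-inst B t) h′)
            (All.map (Refutes-mono (xs⊆x∷xs _ _)) k))
  where h′ = ⊆⟨⟩-↭ p h
refute {r = r} (∃R {B₁ = B} p t π) dΓ gΔ h k
  with g∃ gB ∷ gΔ₀ ← All-resp-↭ p gΔ | kE ∷ kΔ₀ ← All-resp-↭ p k =
  refute π dΓ (IsG-substF _ gB ∷ gΔ₀) h (kB ∷ kΔ₀)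
  where
  kB : Refutes _ _ _
  kB s u = kE s (u∃R (mapConstᵗ r t) (subst (_ ⊢ᵘ_) (mapConst-inst B t) u))
refute {r = r} (∃L {B₁ = B} p c (c∉Γ , c∉Δ) π) dΓ gΔ h k with d∃ dB ∷ dΓ₀ ← All-resp-↭ p dΓ =
  u∃L tt (h′ (here refl)) λ c′ →
    refute {r = r [ c ↦ c′ ]} π (IsD-substF _ dB ∷ dΓ₀) gΔ
      (⊆⟨⟩-∷ (renamed c′) (⊆⟨⟩-[↦] c′ (c∉Γ₀ ∘ there) (h′ ∘ there)))
      (All.tabulate λ m → Refutes-mono (xs⊆x∷xs _ _) (Refutes-[↦] c′ (c∉Δ ∘ lose m) (All.lookup k m)))
  where
  h′ = ⊆⟨⟩-↭ p h
  c∉Γ₀ : ¬ Any (OccF c) (∃' B ∷ _)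
  c∉Γ₀ = c∉Γ ∘ Any-resp-↭ (↭-sym p)
  renamed : ∀ c′ → mapConst (r [ c ↦ c′ ]) (inst B (const c)) ≡ inst (mapConst r B) (const c′)
  renamed c′ = trans (mapConst-inst B (const c))
                     (cong₂ inst (mapConst-[↦]-fresh r c′ B (λ o → c∉Γ₀ (here (∃O o))))
                                 (cong const ([↦]-≡ r c c′)))
refute (∀R p c fr π) dΓ gΔ h k with () ∷ _ ← All-resp-↭ p gΔ

classical⇒uniform : ∀ {G} → All IsD Γ → IsG G → Γ ⊢C G → ¬' G ∷ Γ ⊢O G
classical⇒uniform {Γ = Γ} {G} dΓ gG π =
  ⊢ᵘ⇒⊢O (exFalso gG (refute {r = id} π dΓ (gG ∷ []) Γ⊆¬G∷Γ (¬G-refutes-G ∷ []))) ⊆-refl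
  where
  Γ⊆¬G∷Γ : Γ ⊆⟨ id ⟩ ¬' G ∷ Γ
  Γ⊆¬G∷Γ {F} m = there (subst (_∈ Γ) (sym (mapConst-id F)) m)
  ¬G-refutes-G : Refutes id (¬' G ∷ Γ) G
  ¬G-refutes-G s u = u⊃L tt (s (here refl)) (subst (_ ⊢ᵘ_) (mapConst-id G) u) (uax isBot (here refl))

theorem3 : (G : Fm) (Γ : List Fm) → IsG G → All IsD Γ →
    (Γ ⊢C G) ⇔ ((G ⊃' ⊥') ∷ Γ ⊢O G)
theorem3 G Γ gG dΓ = mk⇔ (classical⇒uniform dΓ gG) (discharge-¬' G ∘ proj₁)
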